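{- For every integer $n\ge 0$, \[ \sum_{j=-n-1}^n q^{2j^2+j}{2n+1 \brack n-j}_{q^2}^2 = (1+q^{2n+1}){4n+1 \brack 2n}_q. \]
   Context: $(a;q)_n=\prod_{k=0}^{n-1}(1-aq^k)$. The Gaussian polynomial is ${m\brack k}_q=\frac{(q;q)_m}{(q;q)_k(q;q)_{m-k}}$ for $0\le k\le m$ and $0$ otherwise; ${m\brack k}_{q^2}$ is the same with $q$ replaced by $q^2$. -}

module Defs where

-- Formal power series in q with integer coefficients: coefficient functions.
-- Identities are compared coefficientwise (pointwise equality).

open import Data.Nat as ℕ using (ℕ; zero; suc; _∸_; _≤?_)
open import Data.Integer as ℤ using (ℤ; +_; -_; _+_; _*_; _-_; ∣_∣)
open import Data.List using (List; map; foldr; upTo)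
open import Relation.Nullary using (yes; no)
open import Relation.Binary.PropositionalEquality using (_≡_)

PS : Set
PS = ℕ → ℤ

sumTo : ℕ → (ℕ → ℤ) → ℤ
sumTo n f = foldr _+_ (+ 0) (map f (upTo n))

0ₚ : PS
0ₚ _ = + 0

1ₚ : PS
1ₚ zero = + 1
1ₚ (suc _) = + 0

qpow : ℕ → PS
qpow e n with n ℕ.≟ e
... | yes _ = + 1
... | no _ = + 0

_⊕_ : PS → PS → PS
(f ⊕ g) n = f n + g n

_⊖_ : PS → PS → PS
(f ⊖ g) n = f n - g n

_⊗_ : PS → PS → PS
(f ⊗ g) n = sumTo (suc n) (λ i → f i * g (n ∸ i))

infixl 6 _⊕_ _⊖_
infixl 7 _⊗_

prodTo : ℕ → (ℕ → PS) → PS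
prodTo zero F = 1ₚ
prodTo (suc m) F = prodTo m F ⊗ F m

-- Multiplicative inverse of a power series f with constant term 1:
-- g 0 = 1,  g k = - Σ_{i=1}^{k} f i * g (k - i).
-- invUpTo f n agrees with the inverse on indices ≤ n.
invUpTo : PS → ℕ → PS
invUpTo f zero = 1ₚ
invUpTo f (suc n) k with k ≤? n
... | yes _ = invUpTo f n k
... | no _ = - sumTo k (λ i → f (suc i) * invUpTo f n (k ∸ suc i))

inv : PS → PS
inv f n = invUpTo f n n

-- (q^d ; q^d)_m = ∏_{k=0}^{m-1} (1 - q^{d(k+1)})   (d = 1: (q;q)_m, d = 2: (q²;q²)_m)
poch : ℕ → ℕ → PS
poch d m = prodTo m (λ k → 1ₚ ⊖ qpow (d ℕ.* suc k))

gaussℕ : ℕ → ℕ → ℕ → PS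
gaussℕ d m k with k ≤? m
... | yes _ = poch d m ⊗ inv (poch d k) ⊗ inv (poch d (m ∸ k))
... | no _ = 0ₚ

gauss : ℕ → ℕ → ℤ → PS
gauss d m (+ k) = gaussℕ d m k
gauss d m ℤ.-[1+ _ ] = 0ₚ

sumPS : List PS → PS
sumPS = foldr _⊕_ 0ₚ

-- Left side: Σ_{j=-n-1}^{n} q^{2j²+j} [2n+1, n-j]_{q²}²,
-- indexed by i = 0..2n+1 with j = i - (n+1).  (2j²+j = j(2j+1) ≥ 0.)
lhs : ℕ → PS
lhs n = sumPS (map term (upTo (suc (suc (2 ℕ.* n)))))
  where
  term : ℕ → PS
  term i = let j = + i - + suc n
               G = gauss 2 (suc (2 ℕ.* n)) (+ n - j)
           in qpow ∣ + 2 * j * j + j ∣ ⊗ G ⊗ G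

rhs : ℕ → PS
rhs n = (1ₚ ⊕ qpow (suc (2 ℕ.* n))) ⊗ gaussℕ 1 (suc (4 ℕ.* n)) (2 ℕ.* n)

-- Expand (−z; q)_{2m} = (−z; q²)_m (−zq; q²)_m with the q-binomial theorem and compare the
-- coefficients of z^m:
--   q^{m(m−1)/2} [2m, m]_q = Σ_{a+b=m} q^{a(a−1)+b²} [m, a]_{q²} [m, b]_{q²}.
-- For m = 2n+1 and a = n+1+j one has [m, a] = [m, b] = [2n+1, n−j] and
-- a(a−1) + b² = m(m−1)/2 + 2j² + j, so the right-hand sum is q^{m(m−1)/2} times the left side of
-- the theorem. On the other hand q-Pascal and the symmetry [4n+1, 2n+1] = [4n+1, 2n] give
-- [4n+2, 2n+1]_q = (1 + q^{2n+1}) [4n+1, 2n]_q.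
-- All series live in the ring ℤ[[q]] of coefficient sequences, where the Pochhammer symbols are
-- invertible, so [m, k] is the unique X with X (q;q)_k (q;q)_{m−k} = (q;q)_m.
module Submission where

open import Defs
open import Algebra.Bundles using (CommutativeRing)
open import Data.Empty using (⊥-elim)
open import Data.Integer as ℤ using (+_; -[1+_]; ∣_∣)
import Data.Integer.Properties as ℤ
import Data.Integer.Solver
open import Data.List using (foldr; map; upTo)
open import Data.List.Properties using (map-upTo)
open import Data.Nat as ℕ using (ℕ; zero; suc; _∸_; _≤_; _<_; _≤?_; s≤s; z≤n)
open import Data.Nat.Combinatorics using (_C_; nC1≡n; nCk+nC[k+1]≡[n+1]C[k+1])
import Data.Nat.Properties as ℕ
import Data.Nat.Solver
open import Data.Product using (_,_)
open import Data.Sum using (inj₁; inj₂)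
open import Function using (_∘_)
open import Level using (0ℓ)
open import Relation.Binary.Definitions using (tri<; tri≈; tri>)
open import Relation.Binary.PropositionalEquality as ≡ using (_≡_)
open import Relation.Nullary using (¬_; yes; no)

module ℕ-Solver = Data.Nat.Solver.+-*-Solver
module ℤ-Solver = Data.Integer.Solver.+-*-Solver

-- Formal power series

module PowerSeries {c ℓ} (R : CommutativeRing c ℓ) where

  open CommutativeRing R
  open import Relation.Binary.Reasoning.Setoid setoid
  open import Algebra.Properties.CommutativeSemigroup +-commutativeSemigroup using (interchange; x∙yz≈y∙xz)

  Series : Set c
  Series = ℕ → Carrier

  infix 4 _≈ₛ_
  _≈ₛ_ : Series → Series → Set ℓ
  f ≈ₛ g = ∀ n → f n ≈ g n

  -- Written with upTo, as in Defs, so that over ℤ the product _*ₛ_ below is definitionally _⊗_.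
  sum : ℕ → (ℕ → Carrier) → Carrier
  sum n h = foldr _+_ 0# (map h (upTo n))

  sum-suc : ∀ n h → sum (suc n) h ≈ h 0 + sum n (h ∘ suc)
  sum-suc n h = reflexive (≡.trans (≡.cong (foldr _+_ 0#) (map-upTo h (suc n)))
                                   (≡.cong (λ xs → h 0 + foldr _+_ 0# xs) (≡.sym (map-upTo (h ∘ suc) n))))

  sum-cong : ∀ n {h h′} → (∀ i → i < n → h i ≈ h′ i) → sum n h ≈ sum n h′
  sum-cong zero    e = refl
  sum-cong (suc n) {h} {h′} e = begin
    sum (suc n) h            ≈⟨ sum-suc n h ⟩
    h 0 + sum n (h ∘ suc)    ≈⟨ +-cong (e 0 (s≤s z≤n)) (sum-cong n (λ i i<n → e (suc i) (s≤s i<n))) ⟩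
    h′ 0 + sum n (h′ ∘ suc)  ≈⟨ sum-suc n h′ ⟨
    sum (suc n) h′           ∎

  sum-distrib-+ : ∀ n h h′ → sum n (λ i → h i + h′ i) ≈ sum n h + sum n h′
  sum-distrib-+ zero    h h′ = sym (+-identityˡ 0#)
  sum-distrib-+ (suc n) h h′ = begin
    sum (suc n) (λ i → h i + h′ i)
      ≈⟨ sum-suc n _ ⟩
    (h 0 + h′ 0) + sum n (λ i → h (suc i) + h′ (suc i))
      ≈⟨ +-congˡ (sum-distrib-+ n (h ∘ suc) (h′ ∘ suc)) ⟩
    (h 0 + h′ 0) + (sum n (h ∘ suc) + sum n (h′ ∘ suc))
      ≈⟨ interchange _ _ _ _ ⟩
    (h 0 + sum n (h ∘ suc)) + (h′ 0 + sum n (h′ ∘ suc))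
      ≈⟨ +-cong (sum-suc n h) (sum-suc n h′) ⟨
    sum (suc n) h + sum (suc n) h′
      ∎

  *-distribˡ-sum : ∀ n a h → a * sum n h ≈ sum n (λ i → a * h i)
  *-distribˡ-sum zero    a h = zeroʳ a
  *-distribˡ-sum (suc n) a h = begin
    a * sum (suc n) h                      ≈⟨ *-congˡ (sum-suc n h) ⟩
    a * (h 0 + sum n (h ∘ suc))            ≈⟨ distribˡ a _ _ ⟩
    a * h 0 + a * sum n (h ∘ suc)          ≈⟨ +-congˡ (*-distribˡ-sum n a (h ∘ suc)) ⟩
    a * h 0 + sum n (λ i → a * h (suc i))  ≈⟨ sum-suc n _ ⟨
    sum (suc n) (λ i → a * h i)            ∎

  infixl 6 _+ₛ_
  infixl 7 _*ₛ_ _·ₛ_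

  _+ₛ_ : Series → Series → Series
  (f +ₛ g) n = f n + g n

  -ₛ_ : Series → Series
  (-ₛ f) n = - f n

  0ₛ : Series
  0ₛ _ = 0#

  1ₛ : Series
  1ₛ zero    = 1#
  1ₛ (suc _) = 0#

  _*ₛ_ : Series → Series → Series
  (f *ₛ g) n = sum (suc n) (λ i → f i * g (n ∸ i))

  _·ₛ_ : Carrier → Series → Series
  (a ·ₛ f) n = a * f n

  tail : Series → Series
  tail f n = f (suc n)

  *ₛ-at0 : ∀ f g → (f *ₛ g) 0 ≈ f 0 * g 0
  *ₛ-at0 f g = trans (sum-suc 0 (λ i → f i * g (0 ∸ i))) (+-identityʳ _)

  *ₛ-suc : ∀ f g n → (f *ₛ g) (suc n) ≈ f 0 * g (suc n) + (tail f *ₛ g) n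
  *ₛ-suc f g n = sum-suc (suc n) _

  tail-*ₛ : ∀ f g → tail (f *ₛ g) ≈ₛ f 0 ·ₛ tail g +ₛ tail f *ₛ g
  tail-*ₛ f g = *ₛ-suc f g

  *ₛ-cong : ∀ {f f′ g g′} → f ≈ₛ f′ → g ≈ₛ g′ → f *ₛ g ≈ₛ f′ *ₛ g′
  *ₛ-cong ef eg n = sum-cong (suc n) (λ i _ → *-cong (ef i) (eg (n ∸ i)))

  *ₛ-zeroˡ : ∀ f → 0ₛ *ₛ f ≈ₛ 0ₛ
  *ₛ-zeroˡ f n = begin
    sum (suc n) (λ i → 0# * f (n ∸ i))  ≈⟨ *-distribˡ-sum (suc n) 0# (λ i → f (n ∸ i)) ⟨
    0# * sum (suc n) (λ i → f (n ∸ i))  ≈⟨ zeroˡ _ ⟩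
    0#                                  ∎

  ·ₛ-*ₛ-assoc : ∀ a f g → (a ·ₛ f) *ₛ g ≈ₛ a ·ₛ (f *ₛ g)
  ·ₛ-*ₛ-assoc a f g n = begin
    sum (suc n) (λ i → (a * f i) * g (n ∸ i))  ≈⟨ sum-cong (suc n) (λ i _ → *-assoc a _ _) ⟩
    sum (suc n) (λ i → a * (f i * g (n ∸ i)))  ≈⟨ *-distribˡ-sum (suc n) a _ ⟨
    a * (f *ₛ g) n                             ∎

  *ₛ-distribʳ-+ₛ : ∀ h f g → (f +ₛ g) *ₛ h ≈ₛ f *ₛ h +ₛ g *ₛ h
  *ₛ-distribʳ-+ₛ h f g n = begin
    sum (suc n) (λ i → (f i + g i) * h (n ∸ i))            ≈⟨ sum-cong (suc n) (λ i _ → distribʳ _ _ _) ⟩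
    sum (suc n) (λ i → f i * h (n ∸ i) + g i * h (n ∸ i))  ≈⟨ sum-distrib-+ (suc n) _ _ ⟩
    (f *ₛ h) n + (g *ₛ h) n                                ∎

  *ₛ-identityˡ : ∀ f → 1ₛ *ₛ f ≈ₛ f
  *ₛ-identityˡ f zero    = trans (*ₛ-at0 1ₛ f) (*-identityˡ _)
  *ₛ-identityˡ f (suc n) = begin
    (1ₛ *ₛ f) (suc n)             ≈⟨ *ₛ-suc 1ₛ f n ⟩
    1# * f (suc n) + (0ₛ *ₛ f) n  ≈⟨ +-cong (*-identityˡ _) (*ₛ-zeroˡ f n) ⟩
    f (suc n) + 0#                ≈⟨ +-identityʳ _ ⟩
    f (suc n)                     ∎

  *ₛ-comm : ∀ f g → f *ₛ g ≈ₛ g *ₛ f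
  *ₛ-comm f g zero = trans (*ₛ-at0 f g) (trans (*-comm _ _) (sym (*ₛ-at0 g f)))
  *ₛ-comm f g (suc zero) = begin
    (f *ₛ g) 1                   ≈⟨ *ₛ-suc f g 0 ⟩
    f 0 * g 1 + (tail f *ₛ g) 0  ≈⟨ +-cong (*-comm _ _) (trans (*ₛ-at0 (tail f) g) (*-comm _ _)) ⟩
    g 1 * f 0 + g 0 * f 1        ≈⟨ +-comm _ _ ⟩
    g 0 * f 1 + g 1 * f 0        ≈⟨ +-congˡ (*ₛ-at0 (tail g) f) ⟨
    g 0 * f 1 + (tail g *ₛ f) 0  ≈⟨ *ₛ-suc g f 0 ⟨
    (g *ₛ f) 1                   ∎
  *ₛ-comm f g (suc (suc n)) = begin
    (f *ₛ g) (2 ℕ.+ n)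
      ≈⟨ *ₛ-suc f g (suc n) ⟩
    f 0 * g (2 ℕ.+ n) + (tail f *ₛ g) (suc n)
      ≈⟨ +-congˡ (trans (*ₛ-comm (tail f) g (suc n)) (*ₛ-suc g (tail f) n)) ⟩
    f 0 * g (2 ℕ.+ n) + (g 0 * f (2 ℕ.+ n) + (tail g *ₛ tail f) n)
      ≈⟨ +-congˡ (+-congˡ (*ₛ-comm (tail g) (tail f) n)) ⟩
    f 0 * g (2 ℕ.+ n) + (g 0 * f (2 ℕ.+ n) + (tail f *ₛ tail g) n)
      ≈⟨ x∙yz≈y∙xz _ _ _ ⟩
    g 0 * f (2 ℕ.+ n) + (f 0 * g (2 ℕ.+ n) + (tail f *ₛ tail g) n)
      ≈⟨ +-congˡ (trans (*ₛ-comm (tail g) f (suc n)) (*ₛ-suc f (tail g) n)) ⟨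
    g 0 * f (2 ℕ.+ n) + (tail g *ₛ f) (suc n)
      ≈⟨ *ₛ-suc g f (suc n) ⟨
    (g *ₛ f) (2 ℕ.+ n)
      ∎

  *ₛ-assoc : ∀ f g h → (f *ₛ g) *ₛ h ≈ₛ f *ₛ (g *ₛ h)
  *ₛ-assoc f g h zero = begin
    ((f *ₛ g) *ₛ h) 0  ≈⟨ trans (*ₛ-at0 (f *ₛ g) h) (*-congʳ (*ₛ-at0 f g)) ⟩
    (f 0 * g 0) * h 0  ≈⟨ *-assoc _ _ _ ⟩
    f 0 * (g 0 * h 0)  ≈⟨ trans (*ₛ-at0 f (g *ₛ h)) (*-congˡ (*ₛ-at0 g h)) ⟨
    (f *ₛ (g *ₛ h)) 0  ∎
  *ₛ-assoc f g h (suc n) = begin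
    ((f *ₛ g) *ₛ h) (suc n)
      ≈⟨ *ₛ-suc (f *ₛ g) h n ⟩
    (f *ₛ g) 0 * h (suc n) + (tail (f *ₛ g) *ₛ h) n
      ≈⟨ +-cong (*-congʳ (*ₛ-at0 f g)) (*ₛ-cong {g = h} (tail-*ₛ f g) (λ _ → refl) n) ⟩
    (f 0 * g 0) * h (suc n) + ((f 0 ·ₛ tail g +ₛ tail f *ₛ g) *ₛ h) n
      ≈⟨ +-cong (*-assoc _ _ _) (*ₛ-distribʳ-+ₛ h _ _ n) ⟩
    f 0 * (g 0 * h (suc n)) + (((f 0 ·ₛ tail g) *ₛ h) n + ((tail f *ₛ g) *ₛ h) n)
      ≈⟨ +-congˡ (+-cong (·ₛ-*ₛ-assoc (f 0) (tail g) h n) (*ₛ-assoc (tail f) g h n)) ⟩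
    f 0 * (g 0 * h (suc n)) + (f 0 * (tail g *ₛ h) n + (tail f *ₛ (g *ₛ h)) n)
      ≈⟨ +-assoc _ _ _ ⟨
    (f 0 * (g 0 * h (suc n)) + f 0 * (tail g *ₛ h) n) + (tail f *ₛ (g *ₛ h)) n
      ≈⟨ +-congʳ (trans (*-congˡ (*ₛ-suc g h n)) (distribˡ _ _ _)) ⟨
    f 0 * (g *ₛ h) (suc n) + (tail f *ₛ (g *ₛ h)) n
      ≈⟨ *ₛ-suc f (g *ₛ h) n ⟨
    (f *ₛ (g *ₛ h)) (suc n)
      ∎

  seriesRing : CommutativeRing c ℓ
  seriesRing = record
    { Carrier = Series
    ; _≈_ = _≈ₛ_
    ; _+_ = _+ₛ_
    ; _*_ = _*ₛ_
    ; -_ = -ₛ_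
    ; 0# = 0ₛ
    ; 1# = 1ₛ
    ; isCommutativeRing = record
      { isRing = record
        { +-isAbelianGroup = Pointwise.isAbelianGroup +-isAbelianGroup
        ; *-cong = *ₛ-cong
        ; *-assoc = *ₛ-assoc
        ; *-identity = *ₛ-identityˡ , λ f n → trans (*ₛ-comm f 1ₛ n) (*ₛ-identityˡ f n)
        ; distrib = (λ h f g n → trans (*ₛ-comm h (f +ₛ g) n)
                                   (trans (*ₛ-distribʳ-+ₛ h f g n) (+-cong (*ₛ-comm f h n) (*ₛ-comm g h n))))
                  , *ₛ-distribʳ-+ₛ
        }
      ; *-comm = *ₛ-comm
      }
    }
    where import Algebra.Construct.Pointwise ℕ as Pointwise

module _ {c ℓ} (R : CommutativeRing c ℓ) where

  open CommutativeRing R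
  open import Algebra.Properties.Ring ring using (-‿distribʳ-*)
  open import Relation.Binary.Reasoning.Setoid setoid

  [1-y]+y[1-x]≈1-xy : ∀ x y → (1# - y) + y * (1# - x) ≈ 1# - x * y
  [1-y]+y[1-x]≈1-xy x y = begin
    (1# - y) + y * (1# - x)   ≈⟨ +-congˡ (trans (distribˡ y 1# (- x)) (+-cong (*-identityʳ y) (sym (-‿distribʳ-* y x)))) ⟩
    (1# - y) + (y - y * x)    ≈⟨ +-assoc 1# (- y) _ ⟩
    1# + (- y + (y - y * x))  ≈⟨ +-congˡ (+-assoc (- y) y _) ⟨
    1# + ((- y + y) - y * x)  ≈⟨ +-congˡ (+-congʳ (-‿inverseˡ y)) ⟩
    1# + (0# - y * x)         ≈⟨ +-congˡ (+-identityˡ _) ⟩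
    1# - y * x                ≈⟨ +-congˡ (-‿cong (*-comm y x)) ⟩
    1# - x * y                ∎

-- Arithmetic of the exponents

suc-C-2 : ∀ k → suc k C 2 ≡ k ℕ.+ k C 2
suc-C-2 k = ≡.trans (≡.sym (nCk+nC[k+1]≡[n+1]C[k+1] k 1)) (≡.cong (ℕ._+ k C 2) (nC1≡n k))

+[2*kC2] : ∀ k → + (2 ℕ.* (k C 2)) ≡ + k ℤ.* (+ k ℤ.- + 1)
+[2*kC2] zero    = ≡.refl
+[2*kC2] (suc k) = begin
  + (2 ℕ.* (suc k C 2))                  ≡⟨ ≡.cong (λ x → + (2 ℕ.* x)) (suc-C-2 k) ⟩
  + (2 ℕ.* (k ℕ.+ k C 2))                ≡⟨ ≡.cong +_ (ℕ.*-distribˡ-+ 2 k (k C 2)) ⟩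
  + (2 ℕ.* k) ℤ.+ + (2 ℕ.* (k C 2))      ≡⟨ ≡.cong₂ ℤ._+_ (ℤ.pos-* 2 k) (+[2*kC2] k) ⟩
  + 2 ℤ.* + k ℤ.+ + k ℤ.* (+ k ℤ.- + 1)  ≡⟨ solve 1 (λ k → con (+ 2) :* k :+ k :* (k :- con (+ 1))
                                                       := (con (+ 1) :+ k) :* ((con (+ 1) :+ k) :- con (+ 1)))
                                                   ≡.refl (+ k) ⟩
  + suc k ℤ.* (+ suc k ℤ.- + 1)          ∎
  where
  open ≡.≡-Reasoning
  open ℤ-Solver

i≡+n⇒+∣i∣≡i : ∀ {i n} → i ≡ + n → + ∣ i ∣ ≡ i
i≡+n⇒+∣i∣≡i ≡.refl = ≡.refl

pos-*-odd : ∀ a b → + a ℤ.* (+ 1 ℤ.+ + 2 ℤ.* + b) ≡ + (a ℕ.* suc (2 ℕ.* b))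
pos-*-odd a b = ≡.trans (≡.cong (λ x → + a ℤ.* (+ 1 ℤ.+ x)) (≡.sym (ℤ.pos-* 2 b)))
                        (≡.sym (ℤ.pos-* a (suc (2 ℕ.* b))))

-- The absolute value in lhs is harmless: 2j² + j = j (2j + 1) ≥ 0.
+∣2j²+j∣ : ∀ j → + ∣ + 2 ℤ.* j ℤ.* j ℤ.+ j ∣ ≡ + 2 ℤ.* j ℤ.* j ℤ.+ j
+∣2j²+j∣ (+ k) = i≡+n⇒+∣i∣≡i (≡.trans
  (solve 1 (λ k → con (+ 2) :* k :* k :+ k := k :* (con (+ 1) :+ con (+ 2) :* k)) ≡.refl (+ k))
  (pos-*-odd k k))
  where open ℤ-Solver
+∣2j²+j∣ -[1+ k ] = i≡+n⇒+∣i∣≡i (≡.trans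
  (solve 1 (λ k → let j = :- (con (+ 1) :+ k) in
                  con (+ 2) :* j :* j :+ j := (con (+ 1) :+ k) :* (con (+ 1) :+ con (+ 2) :* k))
           ≡.refl (+ k))
  (pos-*-odd (suc k) k))
  where open ℤ-Solver

+b≡+m-+a : ∀ {a b m} → a ℕ.+ b ≡ m → + b ≡ + m ℤ.- + a
+b≡+m-+a {a} {b} a+b≡m =
  ≡.trans (solve 2 (λ A B → B := (A :+ B) :- A) ≡.refl (+ a) (+ b)) (≡.cong (λ x → + x ℤ.- + a) a+b≡m)
  where open ℤ-Solver

n-j≡b : ∀ n a b → a ℕ.+ b ≡ suc (2 ℕ.* n) → + n ℤ.- (+ a ℤ.- + suc n) ≡ + b
n-j≡b n a b a+b≡m = ≡.trans
  (solve 2 (λ A N → N :- (A :- (con (+ 1) :+ N)) := (con (+ 1) :+ (N :+ (N :+ con (+ 0)))) :- A) ≡.refl (+ a) (+ n))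
  (≡.sym (+b≡+m-+a a+b≡m))
  where open ℤ-Solver

-- Doubled and read in ℤ, where 2 (k C 2) = k (k − 1), this is a polynomial identity once b = m − a.
exponent-identity : ∀ n a b → a ℕ.+ b ≡ suc (2 ℕ.* n) →
  let j = + a ℤ.- + suc n in
  2 ℕ.* (a C 2) ℕ.+ (b ℕ.+ 2 ℕ.* (b C 2)) ≡ suc (2 ℕ.* n) C 2 ℕ.+ ∣ + 2 ℤ.* j ℤ.* j ℤ.+ j ∣
exponent-identity n a b a+b≡m = ℤ.+-injective (ℤ.*-cancelˡ-≡ (+ 2) _ _ (begin
  + 2 ℤ.* (+ (2 ℕ.* (a C 2)) ℤ.+ (B ℤ.+ + (2 ℕ.* (b C 2))))
    ≡⟨ ≡.cong₂ (λ x y → + 2 ℤ.* (x ℤ.+ (B ℤ.+ y))) (+[2*kC2] a) (+[2*kC2] b) ⟩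
  + 2 ℤ.* (A ℤ.* (A ℤ.- + 1) ℤ.+ (B ℤ.+ B ℤ.* (B ℤ.- + 1)))
    ≡⟨ ≡.cong (λ B → + 2 ℤ.* (A ℤ.* (A ℤ.- + 1) ℤ.+ (B ℤ.+ B ℤ.* (B ℤ.- + 1)))) (+b≡+m-+a {a} a+b≡m) ⟩
  + 2 ℤ.* (A ℤ.* (A ℤ.- + 1) ℤ.+ ((M ℤ.- A) ℤ.+ (M ℤ.- A) ℤ.* ((M ℤ.- A) ℤ.- + 1)))
    ≡⟨ solve 2 (λ A N → let M = con (+ 1) :+ (N :+ (N :+ con (+ 0))) ; j = A :- (con (+ 1) :+ N) in
                  con (+ 2) :* (A :* (A :- con (+ 1)) :+ ((M :- A) :+ (M :- A) :* ((M :- A) :- con (+ 1))))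
                  := M :* (M :- con (+ 1)) :+ con (+ 2) :* (con (+ 2) :* j :* j :+ j))
               ≡.refl A (+ n) ⟩
  M ℤ.* (M ℤ.- + 1) ℤ.+ + 2 ℤ.* (+ 2 ℤ.* j ℤ.* j ℤ.+ j)
    ≡⟨ ≡.cong₂ (λ x y → x ℤ.+ + 2 ℤ.* y) (+[2*kC2] m) (+∣2j²+j∣ j) ⟨
  + (2 ℕ.* (m C 2)) ℤ.+ + 2 ℤ.* + E
    ≡⟨ ≡.cong (ℤ._+ + 2 ℤ.* + E) (ℤ.pos-* 2 (m C 2)) ⟩
  + 2 ℤ.* + (m C 2) ℤ.+ + 2 ℤ.* + E
    ≡⟨ ℤ.*-distribˡ-+ (+ 2) (+ (m C 2)) (+ E) ⟨
  + 2 ℤ.* (+ (m C 2) ℤ.+ + E)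
    ∎))
  where
  open ≡.≡-Reasoning
  open ℤ-Solver
  m = suc (2 ℕ.* n)
  A = + a
  B = + b
  M = + m
  j = + a ℤ.- + suc n
  E = ∣ + 2 ℤ.* j ℤ.* j ℤ.+ j ∣

-- The ring ℤ[[q]]

ℤ[[q]] : CommutativeRing 0ℓ 0ℓ
ℤ[[q]] = PowerSeries.seriesRing ℤ.+-*-commutativeRing

module Q = CommutativeRing ℤ[[q]]
open Q using (_≈_)
open PowerSeries ℤ.+-*-commutativeRing using (sum; sum-cong; tail; *ₛ-at0; *ₛ-suc)
import Relation.Binary.Reasoning.Setoid Q.setoid as ≈-Reasoning
import Algebra.Solver.Ring.NaturalCoefficients.Default Q.commutativeSemiring as Q-Solver

1ₚ≈1# : 1ₚ ≈ Q.1#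
1ₚ≈1# zero    = ≡.refl
1ₚ≈1# (suc _) = ≡.refl

1ₚ⊖f≈1#-f : ∀ f → 1ₚ ⊖ f ≈ Q.1# Q.- f
1ₚ⊖f≈1#-f f n = ≡.cong (ℤ._- f n) (1ₚ≈1# n)

qpow-suc-at0 : ∀ e → qpow (suc e) 0 ≡ + 0
qpow-suc-at0 e with 0 ℕ.≟ suc e
... | no _ = ≡.refl

tail-qpow-suc : ∀ e → tail (qpow (suc e)) ≈ qpow e
tail-qpow-suc e n with n ℕ.≟ e | suc n ℕ.≟ suc e
... | yes _   | yes _   = ≡.refl
... | no  _   | no  _   = ≡.refl
... | yes n≡e | no  n≢e = ⊥-elim (n≢e (≡.cong suc n≡e))
... | no  n≢e | yes n≡e = ⊥-elim (n≢e (ℕ.suc-injective n≡e))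

qpow-zero : qpow 0 ≈ Q.1#
qpow-zero zero    = ≡.refl
qpow-zero (suc n) = qpow-suc-at0 n

qpow-suc-*-at0 : ∀ e f → (qpow (suc e) ⊗ f) 0 ≡ + 0
qpow-suc-*-at0 e f = ≡.trans (*ₛ-at0 (qpow (suc e)) f) (≡.cong (ℤ._* f 0) (qpow-suc-at0 e))

qpow-suc-*-suc : ∀ e f n → (qpow (suc e) ⊗ f) (suc n) ≡ (qpow e ⊗ f) n
qpow-suc-*-suc e f n = begin
  (qpow (suc e) ⊗ f) (suc n)
    ≡⟨ *ₛ-suc (qpow (suc e)) f n ⟩
  qpow (suc e) 0 ℤ.* f (suc n) ℤ.+ (tail (qpow (suc e)) ⊗ f) n
    ≡⟨ ≡.cong₂ ℤ._+_ (≡.cong (ℤ._* f (suc n)) (qpow-suc-at0 e)) (Q.*-congʳ {f} (tail-qpow-suc e) n) ⟩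
  + 0 ℤ.* f (suc n) ℤ.+ (qpow e ⊗ f) n
    ≡⟨ ℤ.+-identityˡ _ ⟩
  (qpow e ⊗ f) n
    ∎
  where open ≡.≡-Reasoning

qpow-*-shift : ∀ e f n → (qpow e ⊗ f) (e ℕ.+ n) ≡ f n
qpow-*-shift zero    f n = Q.trans (Q.*-congʳ {f} qpow-zero) (Q.*-identityˡ f) n
qpow-*-shift (suc e) f n = ≡.trans (qpow-suc-*-suc e f (e ℕ.+ n)) (qpow-*-shift e f n)

qpow-cancelˡ : ∀ e {f g} → qpow e ⊗ f ≈ qpow e ⊗ g → f ≈ g
qpow-cancelˡ e {f} {g} eq n =
  ≡.trans (≡.sym (qpow-*-shift e f n)) (≡.trans (eq (e ℕ.+ n)) (qpow-*-shift e g n))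

qpow-+ : ∀ a b → qpow a ⊗ qpow b ≈ qpow (a ℕ.+ b)
qpow-+ zero    b         = Q.trans (Q.*-congʳ {qpow b} qpow-zero) (Q.*-identityˡ (qpow b))
qpow-+ (suc a) b zero    = ≡.trans (qpow-suc-*-at0 a (qpow b)) (≡.sym (qpow-suc-at0 (a ℕ.+ b)))
qpow-+ (suc a) b (suc n) =
  ≡.trans (qpow-suc-*-suc a (qpow b) n) (≡.trans (qpow-+ a b n) (≡.sym (tail-qpow-suc (a ℕ.+ b) n)))

invUpTo-suc-≤ : ∀ f {n k} → k ≤ n → invUpTo f (suc n) k ≡ invUpTo f n k
invUpTo-suc-≤ f {n} {k} k≤n with k ≤? n
... | yes _   = ≡.refl
... | no  k≰n = ⊥-elim (k≰n k≤n)

invUpTo-stable : ∀ f {n k} → k ≤ n → invUpTo f n k ≡ inv f k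
invUpTo-stable f {zero}  z≤n = ≡.refl
invUpTo-stable f {suc n} k≤1+n with ℕ.m≤n⇒m<n∨m≡n k≤1+n
... | inj₁ (s≤s k≤n) = ≡.trans (invUpTo-suc-≤ f k≤n) (invUpTo-stable f k≤n)
... | inj₂ ≡.refl    = ≡.refl

inv-suc : ∀ f n → inv f (suc n) ≡ ℤ.- sum (suc n) (λ i → f (suc i) ℤ.* inv f (n ∸ i))
inv-suc f n = ≡.trans unfold
  (≡.cong ℤ.-_ (sum-cong (suc n) (λ i _ → ≡.cong (f (suc i) ℤ.*_) (invUpTo-stable f (ℕ.m∸n≤m n i)))))
  where
  unfold : inv f (suc n) ≡ ℤ.- sum (suc n) (λ i → f (suc i) ℤ.* invUpTo f n (n ∸ i))
  unfold with suc n ≤? n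
  ... | yes 1+n≤n = ⊥-elim (ℕ.1+n≰n 1+n≤n)
  ... | no  _     = ≡.refl

inv-inverseʳ : ∀ f → f 0 ≡ + 1 → f ⊗ inv f ≈ Q.1#
inv-inverseʳ f f0≡1 zero    = ≡.trans (*ₛ-at0 f (inv f)) (≡.cong (ℤ._* + 1) f0≡1)
inv-inverseʳ f f0≡1 (suc n) = begin
  (f ⊗ inv f) (suc n)          ≡⟨ *ₛ-suc f (inv f) n ⟩
  f 0 ℤ.* inv f (suc n) ℤ.+ S  ≡⟨ ≡.cong₂ (λ x y → x ℤ.* y ℤ.+ S) f0≡1 (inv-suc f n) ⟩
  + 1 ℤ.* ℤ.- S ℤ.+ S          ≡⟨ ≡.cong (ℤ._+ S) (ℤ.*-identityˡ (ℤ.- S)) ⟩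
  ℤ.- S ℤ.+ S                  ≡⟨ ℤ.+-inverseˡ S ⟩
  + 0                          ∎
  where
  open ≡.≡-Reasoning
  S = sum (suc n) (λ i → f (suc i) ℤ.* inv f (n ∸ i))

*-cancelʳ : ∀ {h f g} → h 0 ≡ + 1 → f ⊗ h ≈ g ⊗ h → f ≈ g
*-cancelʳ {h} {f} {g} h0≡1 fh≈gh = begin
  f                ≈⟨ Q.*-identityʳ f ⟨
  f ⊗ Q.1#         ≈⟨ Q.*-congˡ {f} (inv-inverseʳ h h0≡1) ⟨
  f ⊗ (h ⊗ inv h)  ≈⟨ Q.*-assoc f h (inv h) ⟨
  f ⊗ h ⊗ inv h    ≈⟨ Q.*-congʳ {inv h} fh≈gh ⟩
  g ⊗ h ⊗ inv h    ≈⟨ Q.*-assoc g h (inv h) ⟩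
  g ⊗ (h ⊗ inv h)  ≈⟨ Q.*-congˡ {g} (inv-inverseʳ h h0≡1) ⟩
  g ⊗ Q.1#         ≈⟨ Q.*-identityʳ g ⟩
  g                ∎
  where open ≈-Reasoning

poch-at0 : ∀ d m → poch (suc d) m 0 ≡ + 1
poch-at0 d zero    = ≡.refl
poch-at0 d (suc m) = ≡.trans (*ₛ-at0 (poch (suc d) m) (1ₚ ⊖ qpow (suc d ℕ.* suc m)))
  (≡.cong₂ (λ x y → x ℤ.* (+ 1 ℤ.- y)) (poch-at0 d m) (qpow-suc-at0 (m ℕ.+ d ℕ.* suc m)))

poch-cong : ∀ d {m m′} → m ≡ m′ → poch d m ≈ poch d m′
poch-cong d ≡.refl = Q.refl

gaussℕ-≤ : ∀ d {m k} → k ≤ m → gaussℕ d m k ≡ poch d m ⊗ inv (poch d k) ⊗ inv (poch d (m ∸ k))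
gaussℕ-≤ d {m} {k} k≤m with k ≤? m
... | yes _   = ≡.refl
... | no  k≰m = ⊥-elim (k≰m k≤m)

gaussℕ-≰ : ∀ d {m k} → ¬ k ≤ m → gaussℕ d m k ≡ 0ₚ
gaussℕ-≰ d {m} {k} k≰m with k ≤? m
... | yes k≤m = ⊥-elim (k≰m k≤m)
... | no  _   = ≡.refl

gaussℕ-*-poch : ∀ d {m k} → k ≤ m →
  gaussℕ (suc d) m k ⊗ poch (suc d) k ⊗ poch (suc d) (m ∸ k) ≈ poch (suc d) m
gaussℕ-*-poch d {m} {k} k≤m = begin
  gaussℕ (suc d) m k ⊗ a ⊗ b
    ≈⟨ Q.reflexive (≡.cong (λ G → G ⊗ a ⊗ b) (gaussℕ-≤ (suc d) k≤m)) ⟩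
  P ⊗ inv a ⊗ inv b ⊗ a ⊗ b
    ≈⟨ solve 5 (λ P a a′ b b′ → P :* a′ :* b′ :* a :* b := P :* (a :* a′) :* (b :* b′))
               Q.refl P a (inv a) b (inv b) ⟩
  P ⊗ (a ⊗ inv a) ⊗ (b ⊗ inv b)
    ≈⟨ Q.*-cong (Q.*-congˡ {P} (inv-inverseʳ a (poch-at0 d k))) (inv-inverseʳ b (poch-at0 d (m ∸ k))) ⟩
  P ⊗ Q.1# ⊗ Q.1#
    ≈⟨ Q.trans (Q.*-identityʳ _) (Q.*-identityʳ P) ⟩
  P ∎
  where
  open ≈-Reasoning
  open Q-Solver
  P = poch (suc d) m
  a = poch (suc d) k
  b = poch (suc d) (m ∸ k)

gaussℕ-unique : ∀ d {m k X} → k ≤ m →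
  X ⊗ poch (suc d) k ⊗ poch (suc d) (m ∸ k) ≈ poch (suc d) m → X ≈ gaussℕ (suc d) m k
gaussℕ-unique d {m} {k} k≤m eq =
  *-cancelʳ (poch-at0 d k) (*-cancelʳ (poch-at0 d (m ∸ k)) (Q.trans eq (Q.sym (gaussℕ-*-poch d k≤m))))

gaussℕ-0 : ∀ d m → gaussℕ (suc d) m 0 ≈ Q.1#
gaussℕ-0 d m = Q.sym (gaussℕ-unique d {m} z≤n (begin
  Q.1# ⊗ 1ₚ ⊗ poch (suc d) m    ≈⟨ Q.*-congʳ {poch (suc d) m} (Q.*-congˡ {Q.1#} 1ₚ≈1#) ⟩
  Q.1# ⊗ Q.1# ⊗ poch (suc d) m  ≈⟨ Q.trans (Q.*-congʳ {poch (suc d) m} (Q.*-identityˡ Q.1#)) (Q.*-identityˡ _) ⟩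
  poch (suc d) m                ∎))
  where open ≈-Reasoning

gaussℕ-diag : ∀ d m → gaussℕ (suc d) m m ≈ Q.1#
gaussℕ-diag d m = Q.sym (gaussℕ-unique d {m} ℕ.≤-refl (begin
  Q.1# ⊗ poch (suc d) m ⊗ poch (suc d) (m ∸ m)
    ≈⟨ Q.*-congˡ {Q.1# ⊗ poch (suc d) m} (Q.trans (poch-cong (suc d) (ℕ.n∸n≡0 m)) 1ₚ≈1#) ⟩
  Q.1# ⊗ poch (suc d) m ⊗ Q.1#
    ≈⟨ Q.trans (Q.*-identityʳ _) (Q.*-identityˡ _) ⟩
  poch (suc d) m
    ∎))
  where open ≈-Reasoning

gaussℕ-sym : ∀ d {m k} → k ≤ m → gaussℕ (suc d) m (m ∸ k) ≈ gaussℕ (suc d) m k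
gaussℕ-sym d {m} {k} k≤m = Q.sym (gaussℕ-unique d (ℕ.m∸n≤m m k) (begin
  G ⊗ b ⊗ poch (suc d) (m ∸ (m ∸ k))  ≈⟨ Q.*-congˡ {G ⊗ b} (poch-cong (suc d) (ℕ.m∸[m∸n]≡n k≤m)) ⟩
  G ⊗ b ⊗ a                           ≈⟨ solve 3 (λ G a b → G :* b :* a := G :* a :* b) Q.refl G a b ⟩
  G ⊗ a ⊗ b                           ≈⟨ gaussℕ-*-poch d k≤m ⟩
  poch (suc d) m                      ∎))
  where
  open ≈-Reasoning
  open Q-Solver
  G = gaussℕ (suc d) m k
  a = poch (suc d) k
  b = poch (suc d) (m ∸ k)

gaussℕ-pascal-< : ∀ d {N k} → k < N →
  (gaussℕ (suc d) N (suc k) ⊕ qpow (suc d ℕ.* (N ∸ k)) ⊗ gaussℕ (suc d) N k)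
    ⊗ poch (suc d) (suc k) ⊗ poch (suc d) (N ∸ k)
  ≈ poch (suc d) (suc N)
gaussℕ-pascal-< d {N} {k} k<N = begin
  (A ⊕ qpow (d′ ℕ.* (N ∸ k)) ⊗ B) ⊗ (pk ⊗ U) ⊗ poch d′ (N ∸ k)
    ≈⟨ Q.*-cong (Q.*-congʳ {pk ⊗ U} (Q.+-congˡ {A} (Q.*-congʳ {B} Qd≈Qr))) (poch-cong d′ N∸k≡1+r) ⟩
  (A ⊕ Qr ⊗ B) ⊗ (pk ⊗ U) ⊗ (pr ⊗ V)
    ≈⟨ solve 7 (λ A B pk pr Qr U V → (A :+ Qr :* B) :* (pk :* U) :* (pr :* V)
                                   := V :* (A :* (pk :* U) :* pr) :+ Qr :* U :* (B :* pk :* (pr :* V)))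
               Q.refl A B pk pr Qr U V ⟩
  V ⊗ (A ⊗ (pk ⊗ U) ⊗ pr) ⊕ Qr ⊗ U ⊗ (B ⊗ pk ⊗ (pr ⊗ V))
    ≈⟨ Q.+-cong (Q.*-congˡ {V} (gaussℕ-*-poch d k<N)) (Q.*-congˡ {Qr ⊗ U} hB) ⟩
  V ⊗ P ⊕ Qr ⊗ U ⊗ P
    ≈⟨ solve 4 (λ P Qr U V → V :* P :+ Qr :* U :* P := P :* (V :+ Qr :* U)) Q.refl P Qr U V ⟩
  P ⊗ (V ⊕ Qr ⊗ U)
    ≈⟨ Q.*-congˡ {P} factors ⟩
  P ⊗ (1ₚ ⊖ Qk ⊗ Qr)
    ≈⟨ Q.*-congˡ {P} (λ n → ≡.cong (λ x → 1ₚ n ℤ.- x) (Qk⊗Qr≈qN n)) ⟩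
  poch d′ (suc N)
    ∎
  where
  open ≈-Reasoning
  open Q-Solver
  d′ = suc d
  r = N ∸ suc k
  A = gaussℕ d′ N (suc k)
  B = gaussℕ d′ N k
  P = poch d′ N
  pk = poch d′ k
  pr = poch d′ r
  Qk = qpow (d′ ℕ.* suc k)
  Qr = qpow (d′ ℕ.* suc r)
  U = 1ₚ ⊖ Qk
  V = 1ₚ ⊖ Qr
  N∸k≡1+r : N ∸ k ≡ suc r
  N∸k≡1+r = ℕ.+-∸-assoc 1 k<N
  Qd≈Qr : qpow (d′ ℕ.* (N ∸ k)) ≈ Qr
  Qd≈Qr = Q.reflexive (≡.cong (λ e → qpow (d′ ℕ.* e)) N∸k≡1+r)
  hB : B ⊗ pk ⊗ (pr ⊗ V) ≈ P
  hB = Q.trans (Q.*-congˡ {B ⊗ pk} (poch-cong d′ (≡.sym N∸k≡1+r))) (gaussℕ-*-poch d (ℕ.<⇒≤ k<N))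
  factors : V ⊕ Qr ⊗ U ≈ 1ₚ ⊖ Qk ⊗ Qr
  factors = Q.trans (Q.+-cong (1ₚ⊖f≈1#-f Qr) (Q.*-congˡ {Qr} (1ₚ⊖f≈1#-f Qk)))
                    (Q.trans ([1-y]+y[1-x]≈1-xy ℤ[[q]] Qk Qr) (Q.sym (1ₚ⊖f≈1#-f (Qk ⊗ Qr))))
  k+[1+r]≡N : k ℕ.+ suc r ≡ N
  k+[1+r]≡N = ≡.trans (≡.cong (k ℕ.+_) (≡.sym N∸k≡1+r)) (ℕ.m+[n∸m]≡n (ℕ.<⇒≤ k<N))
  exponents : d′ ℕ.* suc k ℕ.+ d′ ℕ.* suc r ≡ d′ ℕ.* suc N
  exponents = ≡.trans (≡.sym (ℕ.*-distribˡ-+ d′ (suc k) (suc r))) (≡.cong (λ e → d′ ℕ.* suc e) k+[1+r]≡N)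
  Qk⊗Qr≈qN : Qk ⊗ Qr ≈ qpow (d′ ℕ.* suc N)
  Qk⊗Qr≈qN = Q.trans (qpow-+ (d′ ℕ.* suc k) (d′ ℕ.* suc r)) (Q.reflexive (≡.cong qpow exponents))

gaussℕ-pascal : ∀ d N k →
  gaussℕ (suc d) (suc N) (suc k) ≈ gaussℕ (suc d) N (suc k) ⊕ qpow (suc d ℕ.* (N ∸ k)) ⊗ gaussℕ (suc d) N k
gaussℕ-pascal d N k with ℕ.<-cmp k N
... | tri< k<N _ _ = Q.sym (gaussℕ-unique d (s≤s (ℕ.<⇒≤ k<N)) (gaussℕ-pascal-< d k<N))
... | tri≈ _ ≡.refl _ = begin
  gaussℕ (suc d) (suc k) (suc k)
    ≈⟨ gaussℕ-diag d (suc k) ⟩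
  Q.1#
    ≈⟨ Q.+-identityˡ Q.1# ⟨
  0ₚ ⊕ Q.1#
    ≈⟨ Q.+-cong (Q.reflexive (gaussℕ-≰ (suc d) (ℕ.1+n≰n {k}))) diagonal-term ⟨
  gaussℕ (suc d) k (suc k) ⊕ qpow (suc d ℕ.* (k ∸ k)) ⊗ gaussℕ (suc d) k k
    ∎
  where
  open ≈-Reasoning
  d[k∸k]≡0 : suc d ℕ.* (k ∸ k) ≡ 0
  d[k∸k]≡0 = ≡.trans (≡.cong (suc d ℕ.*_) (ℕ.n∸n≡0 k)) (ℕ.*-zeroʳ (suc d))
  diagonal-term : qpow (suc d ℕ.* (k ∸ k)) ⊗ gaussℕ (suc d) k k ≈ Q.1#
  diagonal-term = Q.trans (Q.*-cong (Q.trans (Q.reflexive (≡.cong qpow d[k∸k]≡0)) qpow-zero) (gaussℕ-diag d k))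
                          (Q.*-identityˡ Q.1#)
... | tri> _ _ N<k = begin
  gaussℕ (suc d) (suc N) (suc k)
    ≈⟨ Q.reflexive (gaussℕ-≰ (suc d) (ℕ.<⇒≱ (s≤s N<k))) ⟩
  0ₚ
    ≈⟨ Q.trans (Q.+-congˡ {0ₚ} (Q.zeroʳ (qpow (suc d ℕ.* (N ∸ k))))) (Q.+-identityˡ 0ₚ) ⟨
  0ₚ ⊕ qpow (suc d ℕ.* (N ∸ k)) ⊗ 0ₚ
    ≈⟨ Q.+-cong (Q.reflexive (gaussℕ-≰ (suc d) (ℕ.<⇒≱ (ℕ.m<n⇒m<1+n N<k))))
                (Q.*-congˡ {qpow (suc d ℕ.* (N ∸ k))} (Q.reflexive (gaussℕ-≰ (suc d) (ℕ.<⇒≱ N<k)))) ⟨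
  gaussℕ (suc d) N (suc k) ⊕ qpow (suc d ℕ.* (N ∸ k)) ⊗ gaussℕ (suc d) N k
    ∎
  where open ≈-Reasoning

gaussℕ-central : ∀ d k →
  gaussℕ (suc d) (2 ℕ.* suc k) (suc k) ≈ (1ₚ ⊕ qpow (suc d ℕ.* suc k)) ⊗ gaussℕ (suc d) (suc (2 ℕ.* k)) k
gaussℕ-central d k = begin
  gaussℕ (suc d) (2 ℕ.* suc k) (suc k)
    ≈⟨ Q.reflexive (≡.cong (λ m → gaussℕ (suc d) m (suc k)) (ℕ.*-suc 2 k)) ⟩
  gaussℕ (suc d) (suc N) (suc k)
    ≈⟨ gaussℕ-pascal d N k ⟩
  gaussℕ (suc d) N (suc k) ⊕ qpow (suc d ℕ.* (N ∸ k)) ⊗ G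
    ≈⟨ Q.+-cong (Q.trans (Q.reflexive (≡.cong (gaussℕ (suc d) N) (≡.sym N∸k≡1+k))) (gaussℕ-sym d k≤N))
                (Q.*-congʳ {G} (Q.reflexive (≡.cong (λ e → qpow (suc d ℕ.* e)) N∸k≡1+k))) ⟩
  G ⊕ qpow (suc d ℕ.* suc k) ⊗ G
    ≈⟨ Q.+-congʳ (Q.trans (Q.*-congʳ {G} 1ₚ≈1#) (Q.*-identityˡ G)) ⟨
  1ₚ ⊗ G ⊕ qpow (suc d ℕ.* suc k) ⊗ G
    ≈⟨ Q.distribʳ G 1ₚ (qpow (suc d ℕ.* suc k)) ⟨
  (1ₚ ⊕ qpow (suc d ℕ.* suc k)) ⊗ G
    ∎
  where
  open ≈-Reasoning
  N = suc (2 ℕ.* k)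
  G = gaussℕ (suc d) N k
  k≤N : k ≤ N
  k≤N = ℕ.≤-trans (ℕ.m≤m+n k (k ℕ.+ 0)) (ℕ.n≤1+n _)
  N∸k≡1+k : N ∸ k ≡ suc k
  N∸k≡1+k = ≡.trans (≡.cong (λ x → suc (k ℕ.+ x) ∸ k) (ℕ.+-identityʳ k)) (ℕ.m+n∸n≡m (suc k) k)

-- Polynomials in z over ℤ[[q]] and the q-binomial theorem

module W = PowerSeries ℤ[[q]]

ℤ[[q]][[z]] : CommutativeRing 0ℓ 0ℓ
ℤ[[q]][[z]] = W.seriesRing

module Z = CommutativeRing ℤ[[q]][[z]]

1+_·z : PS → W.Series
(1+ c ·z) zero          = Q.1#
(1+ c ·z) (suc zero)    = c
(1+ c ·z) (suc (suc _)) = 0ₚ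

*-1+·z-at0 : ∀ F c → (F W.*ₛ 1+ c ·z) 0 ≈ F 0
*-1+·z-at0 F c = Q.trans (W.*ₛ-at0 F (1+ c ·z)) (Q.*-identityʳ (F 0))

*-1+·z-suc : ∀ F c k → (F W.*ₛ 1+ c ·z) (suc k) ≈ F (suc k) ⊕ c ⊗ F k
*-1+·z-suc F c k = begin
  (F W.*ₛ 1+ c ·z) (suc k)                        ≈⟨ W.*ₛ-comm F (1+ c ·z) (suc k) ⟩
  ((1+ c ·z) W.*ₛ F) (suc k)                      ≈⟨ W.*ₛ-suc (1+ c ·z) F k ⟩
  Q.1# ⊗ F (suc k) ⊕ (W.tail (1+ c ·z) W.*ₛ F) k  ≈⟨ Q.+-cong (Q.*-identityˡ (F (suc k))) (c·z-* k) ⟩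
  F (suc k) ⊕ c ⊗ F k                             ∎
  where
  open ≈-Reasoning
  c·z-* : ∀ k → (W.tail (1+ c ·z) W.*ₛ F) k ≈ c ⊗ F k
  c·z-* zero    = W.*ₛ-at0 (W.tail (1+ c ·z)) F
  c·z-* (suc k) = begin
    (W.tail (1+ c ·z) W.*ₛ F) (suc k)  ≈⟨ W.*ₛ-suc (W.tail (1+ c ·z)) F k ⟩
    c ⊗ F (suc k) ⊕ (W.0ₛ W.*ₛ F) k    ≈⟨ Q.+-congˡ {c ⊗ F (suc k)} (W.*ₛ-zeroˡ F k) ⟩
    c ⊗ F (suc k) ⊕ Q.0#               ≈⟨ Q.+-identityʳ _ ⟩
    c ⊗ F (suc k)                      ∎

-- zPoch d s N = (−z q^s; q^d)_N = ∏_{i<N} (1 + q^{s+di} z).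
zPoch : ℕ → ℕ → ℕ → W.Series
zPoch d s zero    = W.1ₛ
zPoch d s (suc N) = zPoch d s N W.*ₛ 1+ qpow (s ℕ.+ d ℕ.* N) ·z

zPoch-at0 : ∀ d s N → zPoch d s N 0 ≈ Q.1#
zPoch-at0 d s zero    = Q.refl
zPoch-at0 d s (suc N) = Q.trans (*-1+·z-at0 (zPoch d s N) (qpow (s ℕ.+ d ℕ.* N))) (zPoch-at0 d s N)

zPoch-double : ∀ d s m → zPoch d s (2 ℕ.* m) Z.≈ zPoch (2 ℕ.* d) s m Z.* zPoch (2 ℕ.* d) (s ℕ.+ d) m
zPoch-double d s zero    = Z.sym (Z.*-identityˡ W.1ₛ)
zPoch-double d s (suc m) = begin
  zPoch d s (2 ℕ.* suc m)            ≈⟨ Z.reflexive (≡.cong (zPoch d s) (ℕ.*-suc 2 m)) ⟩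
  zPoch d s (2 ℕ.* m) Z.* x′ Z.* y′  ≈⟨ Z.*-cong (Z.*-cong (zPoch-double d s m) (Z.reflexive x′≡x)) (Z.reflexive y′≡y) ⟩
  A Z.* B Z.* x Z.* y                ≈⟨ Z.*-assoc (A Z.* B) x y ⟩
  A Z.* B Z.* (x Z.* y)              ≈⟨ interchange A B x y ⟩
  A Z.* x Z.* (B Z.* y)              ∎
  where
  open import Relation.Binary.Reasoning.Setoid Z.setoid
  open import Algebra.Properties.CommutativeSemigroup Z.*-commutativeSemigroup using (interchange)
  open ℕ-Solver
  A = zPoch (2 ℕ.* d) s m
  B = zPoch (2 ℕ.* d) (s ℕ.+ d) m
  x′ = 1+ qpow (s ℕ.+ d ℕ.* (2 ℕ.* m)) ·z
  y′ = 1+ qpow (s ℕ.+ d ℕ.* suc (2 ℕ.* m)) ·z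
  x = 1+ qpow (s ℕ.+ 2 ℕ.* d ℕ.* m) ·z
  y = 1+ qpow (s ℕ.+ d ℕ.+ 2 ℕ.* d ℕ.* m) ·z
  even : s ℕ.+ d ℕ.* (2 ℕ.* m) ≡ s ℕ.+ 2 ℕ.* d ℕ.* m
  even = solve 3 (λ s d m → s :+ d :* (con 2 :* m) := s :+ con 2 :* d :* m) ≡.refl s d m
  odd : s ℕ.+ d ℕ.* suc (2 ℕ.* m) ≡ s ℕ.+ d ℕ.+ 2 ℕ.* d ℕ.* m
  odd = solve 3 (λ s d m → s :+ d :* (con 1 :+ con 2 :* m) := s :+ d :+ con 2 :* d :* m) ≡.refl s d m
  x′≡x : x′ ≡ x
  x′≡x = ≡.cong (λ e → 1+ qpow e ·z) even
  y′≡y : y′ ≡ y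
  y′≡y = ≡.cong (λ e → 1+ qpow e ·z) odd

q-binomial-exponents : ∀ d s {N k} → k ≤ N →
  (s ℕ.+ d ℕ.* N) ℕ.+ (s ℕ.* k ℕ.+ d ℕ.* (k C 2)) ≡ (s ℕ.* suc k ℕ.+ d ℕ.* (suc k C 2)) ℕ.+ d ℕ.* (N ∸ k)
q-binomial-exponents d s {N} {k} k≤N rewrite suc-C-2 k | ≡.sym (ℕ.m+[n∸m]≡n k≤N) | ℕ.m+n∸m≡n k (N ∸ k) =
  solve 5 (λ s d k t K → (s :+ d :* (k :+ t)) :+ (s :* k :+ d :* K) := (s :* (con 1 :+ k) :+ d :* (k :+ K)) :+ d :* t)
          ≡.refl s d k (N ∸ k) (k C 2)
  where open ℕ-Solver

q-binomial-shift : ∀ d s N k → let G = gaussℕ (suc d) N k in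
  qpow (s ℕ.+ suc d ℕ.* N) ⊗ (qpow (s ℕ.* k ℕ.+ suc d ℕ.* (k C 2)) ⊗ G)
    ≈ qpow (s ℕ.* suc k ℕ.+ suc d ℕ.* (suc k C 2)) ⊗ (qpow (suc d ℕ.* (N ∸ k)) ⊗ G)
q-binomial-shift d s N k with ℕ.≤-<-connex k N
... | inj₁ k≤N = begin
  qpow eN ⊗ (qpow e₀ ⊗ G)  ≈⟨ Q.*-assoc (qpow eN) (qpow e₀) G ⟨
  qpow eN ⊗ qpow e₀ ⊗ G    ≈⟨ Q.*-congʳ {G} (Q.trans (qpow-+ eN e₀) (Q.reflexive (≡.cong qpow exponents))) ⟩
  qpow (e₁ ℕ.+ eD) ⊗ G     ≈⟨ Q.*-congʳ {G} (qpow-+ e₁ eD) ⟨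
  qpow e₁ ⊗ qpow eD ⊗ G    ≈⟨ Q.*-assoc (qpow e₁) (qpow eD) G ⟩
  qpow e₁ ⊗ (qpow eD ⊗ G)  ∎
  where
  open ≈-Reasoning
  eN = s ℕ.+ suc d ℕ.* N
  e₀ = s ℕ.* k ℕ.+ suc d ℕ.* (k C 2)
  e₁ = s ℕ.* suc k ℕ.+ suc d ℕ.* (suc k C 2)
  eD = suc d ℕ.* (N ∸ k)
  G = gaussℕ (suc d) N k
  exponents : eN ℕ.+ e₀ ≡ e₁ ℕ.+ eD
  exponents = q-binomial-exponents (suc d) s k≤N
... | inj₂ N<k = begin
  x ⊗ (y ⊗ G)     ≈⟨ Q.*-congˡ {x} (Q.*-congˡ {y} G≈0) ⟩
  x ⊗ (y ⊗ Q.0#)  ≈⟨ Q.trans (Q.*-congˡ {x} (Q.zeroʳ y)) (Q.zeroʳ x) ⟩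
  Q.0#            ≈⟨ Q.trans (Q.*-congˡ {u} (Q.zeroʳ v)) (Q.zeroʳ u) ⟨
  u ⊗ (v ⊗ Q.0#)  ≈⟨ Q.*-congˡ {u} (Q.*-congˡ {v} G≈0) ⟨
  u ⊗ (v ⊗ G)     ∎
  where
  open ≈-Reasoning
  x = qpow (s ℕ.+ suc d ℕ.* N)
  y = qpow (s ℕ.* k ℕ.+ suc d ℕ.* (k C 2))
  u = qpow (s ℕ.* suc k ℕ.+ suc d ℕ.* (suc k C 2))
  v = qpow (suc d ℕ.* (N ∸ k))
  G = gaussℕ (suc d) N k
  G≈0 : G ≈ Q.0#
  G≈0 = Q.reflexive (gaussℕ-≰ (suc d) (ℕ.<⇒≱ N<k))

q-binomial : ∀ d s N k → zPoch (suc d) s N k ≈ qpow (s ℕ.* k ℕ.+ suc d ℕ.* (k C 2)) ⊗ gaussℕ (suc d) N k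
q-binomial d s N zero = begin
  zPoch (suc d) s N 0
    ≈⟨ zPoch-at0 (suc d) s N ⟩
  Q.1#
    ≈⟨ Q.*-identityˡ Q.1# ⟨
  Q.1# ⊗ Q.1#
    ≈⟨ Q.*-cong (Q.trans (Q.reflexive (≡.cong qpow e≡0)) qpow-zero) (gaussℕ-0 d N) ⟨
  qpow (s ℕ.* 0 ℕ.+ suc d ℕ.* 0) ⊗ gaussℕ (suc d) N 0
    ∎
  where
  open ≈-Reasoning
  e≡0 : s ℕ.* 0 ℕ.+ suc d ℕ.* 0 ≡ 0
  e≡0 = ≡.cong₂ ℕ._+_ (ℕ.*-zeroʳ s) (ℕ.*-zeroʳ (suc d))
q-binomial d s zero (suc k) =
  Q.sym (Q.trans (Q.*-congˡ {q^e} (Q.reflexive (gaussℕ-≰ (suc d) {0} {suc k} λ ()))) (Q.zeroʳ q^e))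
  where q^e = qpow (s ℕ.* suc k ℕ.+ suc d ℕ.* (suc k C 2))
q-binomial d s (suc N) (suc k) = begin
  (zPoch (suc d) s N W.*ₛ 1+ c ·z) (suc k)
    ≈⟨ *-1+·z-suc (zPoch (suc d) s N) c k ⟩
  zPoch (suc d) s N (suc k) ⊕ c ⊗ zPoch (suc d) s N k
    ≈⟨ Q.+-cong (q-binomial d s N (suc k)) (Q.*-congˡ {c} (q-binomial d s N k)) ⟩
  Q₁ ⊗ G₁ ⊕ c ⊗ (Q₀ ⊗ G₀)
    ≈⟨ Q.+-congˡ {Q₁ ⊗ G₁} (q-binomial-shift d s N k) ⟩
  Q₁ ⊗ G₁ ⊕ Q₁ ⊗ (Qd ⊗ G₀)
    ≈⟨ Q.distribˡ Q₁ G₁ (Qd ⊗ G₀) ⟨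
  Q₁ ⊗ (G₁ ⊕ Qd ⊗ G₀)
    ≈⟨ Q.*-congˡ {Q₁} (gaussℕ-pascal d N k) ⟨
  Q₁ ⊗ gaussℕ (suc d) (suc N) (suc k)
    ∎
  where
  open ≈-Reasoning
  c = qpow (s ℕ.+ suc d ℕ.* N)
  Q₁ = qpow (s ℕ.* suc k ℕ.+ suc d ℕ.* (suc k C 2))
  Q₀ = qpow (s ℕ.* k ℕ.+ suc d ℕ.* (k C 2))
  Qd = qpow (suc d ℕ.* (N ∸ k))
  G₁ = gaussℕ (suc d) N (suc k)
  G₀ = gaussℕ (suc d) N k

-- Comparing coefficients

-- The summand of lhs at index a, i.e. at j = a − (n+1); Defs keeps it local to lhs.
lhsTerm : ℕ → ℕ → PS
lhsTerm n a = qpow ∣ + 2 ℤ.* j ℤ.* j ℤ.+ j ∣ ⊗ G ⊗ G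
  where
  j = + a ℤ.- + suc n
  G = gauss 2 (suc (2 ℕ.* n)) (+ n ℤ.- j)

zPoch-product-term : ∀ n a → a ≤ suc (2 ℕ.* n) →
  let m = suc (2 ℕ.* n) in zPoch 2 0 m a ⊗ zPoch 2 1 m (m ∸ a) ≈ qpow (m C 2) ⊗ lhsTerm n a
zPoch-product-term n a a≤m = begin
  zPoch 2 0 m a ⊗ zPoch 2 1 m b
    ≈⟨ Q.*-cong (q-binomial 1 0 m a) (q-binomial 1 1 m b) ⟩
  qpow eA ⊗ gaussℕ 2 m a ⊗ (qpow eB ⊗ G)
    ≈⟨ Q.*-congʳ {qpow eB ⊗ G} (Q.*-congˡ {qpow eA} (Q.sym (gaussℕ-sym 1 a≤m))) ⟩
  qpow eA ⊗ G ⊗ (qpow eB ⊗ G)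
    ≈⟨ solve 3 (λ x y G → x :* G :* (y :* G) := x :* y :* (G :* G)) Q.refl (qpow eA) (qpow eB) G ⟩
  qpow eA ⊗ qpow eB ⊗ (G ⊗ G)
    ≈⟨ Q.*-congʳ {G ⊗ G} (Q.trans (qpow-+ eA eB) (Q.reflexive (≡.cong qpow exponents))) ⟩
  qpow (m C 2 ℕ.+ E) ⊗ (G ⊗ G)
    ≈⟨ Q.*-congʳ {G ⊗ G} (qpow-+ (m C 2) E) ⟨
  qpow (m C 2) ⊗ qpow E ⊗ (G ⊗ G)
    ≈⟨ solve 3 (λ x y G → x :* y :* (G :* G) := x :* (y :* G :* G)) Q.refl (qpow (m C 2)) (qpow E) G ⟩
  qpow (m C 2) ⊗ (qpow E ⊗ G ⊗ G)
    ≈⟨ Q.*-congˡ {qpow (m C 2)} (Q.reflexive term≡) ⟨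
  qpow (m C 2) ⊗ lhsTerm n a
    ∎
  where
  open ≈-Reasoning
  open Q-Solver
  m = suc (2 ℕ.* n)
  b = m ∸ a
  a+b≡m : a ℕ.+ b ≡ m
  a+b≡m = ℕ.m+[n∸m]≡n a≤m
  j = + a ℤ.- + suc n
  E = ∣ + 2 ℤ.* j ℤ.* j ℤ.+ j ∣
  eA = 0 ℕ.* a ℕ.+ 2 ℕ.* (a C 2)
  eB = 1 ℕ.* b ℕ.+ 2 ℕ.* (b C 2)
  G = gaussℕ 2 m b
  term≡ : lhsTerm n a ≡ qpow E ⊗ G ⊗ G
  term≡ = ≡.cong (λ i → qpow E ⊗ gauss 2 m i ⊗ gauss 2 m i) (n-j≡b n a b a+b≡m)
  exponents : eA ℕ.+ eB ≡ m C 2 ℕ.+ E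
  exponents = ≡.trans (≡.cong (λ x → 2 ℕ.* (a C 2) ℕ.+ (x ℕ.+ 2 ℕ.* (b C 2))) (ℕ.*-identityˡ b))
                      (exponent-identity n a b a+b≡m)

gaussℕ≈lhs : ∀ n → let m = suc (2 ℕ.* n) in gaussℕ 1 (2 ℕ.* m) m ≈ lhs n
gaussℕ≈lhs n = qpow-cancelˡ (m C 2) (begin
  qpow (m C 2) ⊗ gaussℕ 1 (2 ℕ.* m) m
    ≈⟨ Q.*-congʳ {gaussℕ 1 (2 ℕ.* m) m} (Q.reflexive (≡.cong qpow (ℕ.+-identityʳ (m C 2)))) ⟨
  qpow (0 ℕ.* m ℕ.+ 1 ℕ.* (m C 2)) ⊗ gaussℕ 1 (2 ℕ.* m) m
    ≈⟨ q-binomial 0 0 (2 ℕ.* m) m ⟨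
  zPoch 1 0 (2 ℕ.* m) m
    ≈⟨ zPoch-double 1 0 m m ⟩
  W.sum (suc m) (λ a → zPoch 2 0 m a ⊗ zPoch 2 1 m (m ∸ a))
    ≈⟨ W.sum-cong (suc m) (λ a a<1+m → zPoch-product-term n a (ℕ.s≤s⁻¹ a<1+m)) ⟩
  W.sum (suc m) (λ a → qpow (m C 2) ⊗ lhsTerm n a)
    ≈⟨ W.*-distribˡ-sum (suc m) (qpow (m C 2)) (lhsTerm n) ⟨
  qpow (m C 2) ⊗ lhs n
    ∎)
  where
  open ≈-Reasoning
  m = suc (2 ℕ.* n)

gaussℕ≈rhs : ∀ n → let m = suc (2 ℕ.* n) in gaussℕ 1 (2 ℕ.* m) m ≈ rhs n
gaussℕ≈rhs n = Q.trans (gaussℕ-central 0 (2 ℕ.* n))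
  (Q.reflexive (≡.cong₂ (λ e N → (1ₚ ⊕ qpow e) ⊗ gaussℕ 1 (suc N) (2 ℕ.* n))
                        (ℕ.*-identityˡ (suc (2 ℕ.* n))) (≡.sym (ℕ.*-assoc 2 2 n))))

theorem8p1 : (n : ℕ) → (k : ℕ) → lhs n k ≡ rhs n k
theorem8p1 n = Q.trans (Q.sym (gaussℕ≈lhs n)) (gaussℕ≈rhs n)
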